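{- Let $0\le k\le n$, and let $w^{\odot}\in S_{n,k}^{\odot}$ have associated Bruhat interval $[u,v]$ and positroid $\mathcal{M}$. For any $y\in[u,v]$, the codimension of the tangent space to $\Pi_{[u,v]}\subseteq Gr(k,n)$ at $A_{y[k]}$ is \[\operatorname{rank}(Jac|_{A_{y[k]}})=\#\Big\{I\in\binom{[n]}{k}\setminus\mathcal{M}: |I\cap y[k]|=k-1\Big\}.\]
   Context: $[n]=\{1,\dots,n\}$ and $\binom{[n]}{k}$ is the set of $k$-subsets of $[n]$. $Gr(k,n)$ is the Grassmannian of $k$-dimensional subspaces of $\mathbb{C}^n$; a point is the row span of a full-rank $k\times n$ complex matrix, and for $I\in\binom{[n]}{k}$ the Plücker coordinate $\Delta_I$ is the $k\times k$ minor in the columns $I$. For $J=\{j_1<\dots<j_k\}$, $A_J\in Gr(k,n)$ is the row span of the $k\times n$ matrix with a $1$ in cell $(i,j_i)$ for each $i$ and $0$ elsewhere. For $y\in S_n$, $y[k]=\{y(1),\dots,y(k)\}$. A decorated permutation on $n$ elements is a permutation $w\in S_n$ together with a label "clockwise" or "counterclockwise" on each fixed point. An element $i$ is an anti-exceedance if $i<w^{ -1}(i)$ or $i$ is a clockwise fixed point; $S_{n,k}^{\odot}$ is the set of decorated permutations on $n$ elements with exactly $k$ anti-exceedances. For $r\in[n]$ let $<_r$ be the order $r<_r r+1<_r\cdots<_r n<_r 1<_r\cdots<_r r-1$, and $I_r(w)=\{i: i<_r w^{ -1}(i)\text{ or } i \text{ is a clockwise fixed point}\}$. For $I=\{i_1<_r\dots<_r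 i_k\}$, $J=\{j_1<_r\dots<_r j_k\}$, write $I\preceq_r J$ if $i_h\le_r j_h$ for all $h$. The positroid is $\mathcal{M}=\{I\in\binom{[n]}{k}: I_r(w)\preceq_r I\ \forall r\}$. The associated Bruhat interval $[u,v]$: $v$ is the unique permutation with $v(1)<\dots<v(k)$, $v(k+1)<\dots<v(n)$ and $\{v(1),\dots,v(k)\}=w^{ -1}(I_1(w))$, and $u=wv$ ($u(i)=w(v(i))$); $[u,v]=\{y: u\le y\le v\}$ in Bruhat order ($x\le y$ iff for each $i$ the sorted $\{x(1),\dots,x(i)\}$ is componentwise $\le$ the sorted $\{y(1),\dots,y(i)\}$). The positroid variety $\Pi_{[u,v]}$ is the subvariety of $Gr(k,n)$ whose vanishing ideal is generated by $\{\Delta_I:I\notin\mathcal{M}\}$ (equivalently the projection $V_\bullet\mapsto V_k$ of the Richardson variety $X_u\cap X^v$ in the complete flag variety). $Jac$ denotes the Jacobian matrix of the defining polynomials $\{\Delta_I:I\notin\mathcal{M}\}$ (in local coordinates on $Gr(k,n)$), so that $\operatorname{rank}(Jac|_x)$ is the codimension in $Gr(k,n)$ of the tangent space to $\Pi_{[u,v]}$ at $x$. -}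

module Defs where

open import Data.Nat as ℕ using (ℕ; zero; suc; _∸_; _<ᵇ_; _≤ᵇ_)
open import Data.Nat.Properties as ℕP using ()
open import Data.Bool using (Bool; true; false; _∧_; _∨_; if_then_else_; not; T)
open import Data.Fin as Fin using (Fin; toℕ; punchIn)
open import Data.Fin.Properties as FinP using (all?)
open import Data.Fin.Subset using (Subset; _∈_; ∣_∣; _∩_)
open import Data.Fin.Permutation using (Permutation′; _⟨$⟩ʳ_; _⟨$⟩ˡ_)
open import Data.List as List using (List; []; _∷_; _++_; filterᵇ; allFin; foldr; length; map)
import Data.Bool.ListAction as BL
open import Data.List.Relation.Binary.Pointwise using (Pointwise)
import Data.List.Relation.Binary.Pointwise.Properties as PwP
open import Data.Vec as Vec using (Vec; tabulate; lookup)
open import Data.Product using (Σ; _×_; _,_; proj₁; proj₂; ∃)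
open import Data.Rational as ℚ using (ℚ; 0ℚ; 1ℚ)
open import Relation.Nullary using (¬_; Dec; does)
open import Relation.Nullary.Decidable using (¬?; _×-dec_)
open import Relation.Binary.PropositionalEquality using (_≡_)

-- Conventions: [n] = {1,…,n} is modelled by Fin n = {0,…,n-1}
-- (order-preserving shift i ↦ i-1).  A subset of [n] is a
-- Data.Fin.Subset (a Vec Bool n); a k-subset is one with ∣ I ∣ ≡ k.

_==_ : ∀ {n} → Fin n → Fin n → Bool
i == j = does (i Fin.≟ j)

-- The cyclic orders <_r.  posR r i is the position of i in the list
-- r <_r r+1 <_r … <_r n <_r 1 <_r … <_r r-1  (starting at 0).

posR : ∀ {n} → Fin n → Fin n → ℕ
posR {n} r i = if toℕ r ≤ᵇ toℕ i then toℕ i ∸ toℕ r else (toℕ i ℕ.+ n) ∸ toℕ r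

rotList : ∀ {n} → Fin n → List (Fin n)
rotList {n} r = filterᵇ (λ i → toℕ r ≤ᵇ toℕ i) (allFin n)
             ++ filterᵇ (λ i → toℕ i <ᵇ toℕ r) (allFin n)

sortedR : ∀ {n} → Fin n → Subset n → List (Fin n)
sortedR r I = filterᵇ (λ i → lookup I i) (rotList r)

GaleR : ∀ {n} → Fin n → Subset n → Subset n → Set
GaleR r I J = Pointwise (λ a b → posR r a ℕ.≤ posR r b) (sortedR r I) (sortedR r J)

-- A decorated permutation is a permutation w
-- together with a labelling dec : Fin n → Bool, where on a fixed point
-- dec i = true means "clockwise" and false "counterclockwise" (the
-- label on non-fixed points is irrelevant).

clockwiseFixed : ∀ {n} → Permutation′ n → (Fin n → Bool) → Fin n → Bool
clockwiseFixed w dec i = ((w ⟨$⟩ʳ i) == i) ∧ dec i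

antiExc : ∀ {n} → Permutation′ n → (Fin n → Bool) → Subset n
antiExc w dec = tabulate (λ i → (toℕ i <ᵇ toℕ (w ⟨$⟩ˡ i)) ∨ clockwiseFixed w dec i)

InSnk : ∀ {n} → ℕ → Permutation′ n → (Fin n → Bool) → Set
InSnk k w dec = ∣ antiExc w dec ∣ ≡ k

Ir : ∀ {n} → Permutation′ n → (Fin n → Bool) → Fin n → Subset n
Ir w dec r = tabulate (λ i → (posR r i <ᵇ posR r (w ⟨$⟩ˡ i)) ∨ clockwiseFixed w dec i)

InPositroid : ∀ {n} → ℕ → Permutation′ n → (Fin n → Bool) → Subset n → Set
InPositroid k w dec I = (∣ I ∣ ≡ k) × (∀ r → GaleR r (Ir w dec r) I)

InPositroid? : ∀ {n} k w dec (I : Subset n) → Dec (InPositroid k w dec I)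
InPositroid? k w dec I =
  (∣ I ∣ ℕ.≟ k) ×-dec all? (λ r → PwP.decidable (λ a b → posR r a ℕ.≤? posR r b) _ _)

prefixSet : ∀ {n} → (Fin n → Fin n) → ℕ → Subset n
prefixSet {n} x i = tabulate (λ c → BL.any (λ m → (toℕ m <ᵇ i) ∧ (x m == c)) (allFin n))

sorted : ∀ {n} → Subset n → List (Fin n)
sorted {n} S = filterᵇ (λ c → lookup S c) (allFin n)

BruhatLe : ∀ {n} → (Fin n → Fin n) → (Fin n → Fin n) → Set
BruhatLe {n} x y = ∀ i → i ℕ.≤ n →
  Pointwise Fin._≤_ (sorted (prefixSet x i)) (sorted (prefixSet y i))

-- v is the permutation of the Bruhat interval attached to w^⊙:
-- v(1)<…<v(k), v(k+1)<…<v(n), {v(1),…,v(k)} = w⁻¹(I_1(w))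
IsTopPerm : ∀ {n} → ℕ → Permutation′ n → (Fin n → Bool) → Permutation′ n → Set
IsTopPerm {n} k w dec v =
    (∀ (a b : Fin n) → a Fin.< b → toℕ b ℕ.< k → (v ⟨$⟩ʳ a) Fin.< (v ⟨$⟩ʳ b))
  × (∀ (a b : Fin n) → a Fin.< b → k ℕ.≤ toℕ a → (v ⟨$⟩ʳ a) Fin.< (v ⟨$⟩ʳ b))
  × (prefixSet (v ⟨$⟩ʳ_) k ≡ tabulate (λ c → lookup (antiExc w dec) (w ⟨$⟩ʳ c)))

-- Determinants and derivatives.
-- Dual numbers ℚ[ε]/(ε²): the ε-coefficient of p(x + ε e) is the
-- directional derivative of the polynomial p at x in direction e.

D : Set
D = ℚ × ℚ

_+D_ : D → D → D
(a , b) +D (c , d) = (a ℚ.+ c , b ℚ.+ d)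

_*D_ : D → D → D
(a , b) *D (c , d) = (a ℚ.* c , (a ℚ.* d) ℚ.+ (b ℚ.* c))

negD : D → D
negD (a , b) = (ℚ.- a , ℚ.- b)

0D 1D : D
0D = (0ℚ , 0ℚ)
1D = (1ℚ , 0ℚ)

sumD : ∀ {m} → (Fin m → D) → D
sumD {m} f = foldr (λ j acc → f j +D acc) 0D (allFin m)

det : (k : ℕ) → (Fin k → Fin k → D) → D
det zero    M = 1D
det (suc k) M = sumD (λ j →
  let t = M Fin.zero j *D det k (λ a b → M (Fin.suc a) (punchIn j b))
  in if (toℕ j ℕ.% 2) ℕ.≡ᵇ 0 then t else negD t)

rankIn : ∀ {n} → Subset n → Fin n → ℕ
rankIn {n} J c = length (filterᵇ (λ j → lookup J j ∧ (toℕ j <ᵇ toℕ c)) (allFin n))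

-- The standard affine chart of Gr(k,n) around A_J (J a k-subset,
-- J = {j_1<…<j_k}): k×n matrices whose columns j_1,…,j_k form the
-- identity, the remaining entries x_{a,c} (c ∉ J) being the local
-- coordinates; A_J is the origin x = 0.  chartDir J a₀ c₀ is the
-- chart matrix at the point x = ε·e_{(a₀,c₀)} over the dual numbers.
chartDir : ∀ {n} k → Subset n → Fin k → Fin n → Fin k → Fin n → D
chartDir k J a₀ c₀ a c =
  ( (if lookup J c ∧ (rankIn J c ℕ.≡ᵇ toℕ a) then 1ℚ else 0ℚ)
  , (if (a == a₀) ∧ (c == c₀) then 1ℚ else 0ℚ) )

colSub : ∀ {n} k → Subset n → (Fin k → Fin n → D) → Fin k → Fin k → D
colSub {n} k I M a b =
  sumD (λ c → if lookup I c ∧ (rankIn I c ℕ.≡ᵇ toℕ b) then M a c else 0D)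

-- ∂Δ_I / ∂x_{a₀,c₀} evaluated at A_J, in the chart around A_J
jacEntry : ∀ {n} k → Subset n → Subset n → Fin k → Fin n → ℚ
jacEntry k J I a₀ c₀ = proj₂ (det k (colSub k I (chartDir k J a₀ c₀)))

sumℚ : ∀ {m} → (Fin m → ℚ) → ℚ
sumℚ {m} f = foldr (λ j acc → f j ℚ.+ acc) 0ℚ (allFin m)

LinIndepRows : ∀ {R C : Set} → (R → C → ℚ) → ∀ {r} → (Fin r → R) → Set
LinIndepRows {C = C} M {r} ρ =
  ∀ (coef : Fin r → ℚ) → (∀ (col : C) → sumℚ (λ i → coef i ℚ.* M (ρ i) col) ≡ 0ℚ) →
  ∀ i → coef i ≡ 0ℚ

HasRank : ∀ {R C : Set} → (R → C → ℚ) → ℕ → Set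
HasRank {R} M r =
  Σ (Fin r → R) (λ ρ → LinIndepRows M ρ) ×
  (∀ (ρ : Fin (suc r) → R) → ¬ LinIndepRows M ρ)

JacRow : ∀ {n} → ℕ → Permutation′ n → (Fin n → Bool) → Set
JacRow {n} k w dec = Σ (Subset n) (λ I → (∣ I ∣ ≡ k) × ¬ InPositroid k w dec I)

JacCol : ∀ {n} → ℕ → Subset n → Set
JacCol {n} k J = Σ (Fin k × Fin n) (λ ac → ¬ (proj₂ ac ∈ J))

Jac : ∀ {n} k (w : Permutation′ n) (dec : Fin n → Bool) (J : Subset n) →
      JacRow k w dec → JacCol k J → ℚ
Jac k w dec J (I , _) ((a , c) , _) = jacEntry k J I a c

allSubsets : (n : ℕ) → List (Subset n)
allSubsets zero    = Vec.[] ∷ []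
allSubsets (suc n) = map (true Vec.∷_) (allSubsets n) ++ map (false Vec.∷_) (allSubsets n)

countNearby : ∀ {n} → ℕ → Permutation′ n → (Fin n → Bool) → Subset n → ℕ
countNearby {n} k w dec J = length (List.filter
  (λ I → (∣ I ∣ ℕ.≟ k) ×-dec ¬? (InPositroid? k w dec I) ×-dec (suc ∣ I ∩ J ∣ ℕ.≟ k))
  (allSubsets n))

{-# OPTIONS --safe #-}
-- At the coordinate point A_J, in the affine chart centred there, the derivative of Δ_I along the
-- coordinate x_{a,c} (c ∉ J) is the ε-part of a k×k determinant whose real part is the 0/1 matrix of a
-- partial matching (the column of c ∈ I ∩ J is the unit vector of the row of c in J) and whose ε-part
-- is a single matrix unit.  Expanding along the first row, that ε-part is ±1 when the other rows and
-- columns are perfectly matched and 0 otherwise, which happens exactly when I = (J ∖ {j_a}) ∪ {c}.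
-- So the row of Δ_I in the Jacobian is zero unless |I ∩ J| = k − 1, and then it has an entry ±1 in a
-- column where every other row vanishes; the rank is therefore the number of such I outside the
-- positroid.  The argument works at every coordinate point A_J, so the hypotheses tying w, v and y
-- together are not needed.
module Submission where

open import Defs

open import Data.Bool as Bool using (Bool; true; false; _∧_; _∨_; not; if_then_else_)
import Data.Bool.Properties as BoolP
open import Data.Empty using (⊥-elim)
open import Data.Fin as Fin using (Fin; toℕ; punchIn; punchOut)
import Data.Fin.Properties as FinP
open import Data.Fin.Permutation using (Permutation′; _⟨$⟩ʳ_; _⟨$⟩ˡ_; inverseˡ)
open import Data.Fin.Subset using (Subset; ∣_∣; _∩_; _∈_)
open import Data.List as List using (List; length; filterᵇ)
import Data.List.Membership.DecPropositional
open import Data.List.Membership.Propositional using (lose) renaming (_∈_ to _∈ˡ_)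
open import Data.List.Membership.Propositional.Properties
  using (∈-lookup; ∈-allFin; ∈-map⁺; ∈-map⁻; ∈-++⁺ˡ; ∈-++⁺ʳ; ∈-filter⁺; ∈-filter⁻)
import Data.List.Relation.Unary.All as All
open import Data.List.Relation.Unary.AllPairs as AllPairs using (_∷_)
import Data.List.Relation.Unary.Any as Any
import Data.List.Relation.Unary.Any.Properties as AnyP
open import Data.List.Relation.Unary.Unique.Propositional using (Unique)
import Data.List.Relation.Unary.Unique.Propositional.Properties as Unique
open import Data.Nat as ℕ using (ℕ; zero; suc; _+_; _≤_; _<_; _<ᵇ_; _≡ᵇ_; z≤n; s≤s)
import Data.Nat.Properties as ℕP
open import Data.Product as Prod using (Σ; ∃; _×_; _,_; proj₁; proj₂)
open import Data.Rational as ℚ using (ℚ; 0ℚ; 1ℚ)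
import Data.Rational.Properties as ℚP
open import Data.Sum as Sum using (_⊎_; inj₁; inj₂)
open import Data.Vec as Vec using (lookup; _∷_; [])
import Data.Vec.Properties as VecP
open import Function using (_∘_; _⇔_; Equivalence; mk⇔)
open import Relation.Binary using (DecidableEquality; tri<; tri≈; tri>)
open import Relation.Binary.PropositionalEquality
open import Relation.Nullary using (¬_; Dec; yes; no; contradiction)
open import Relation.Nullary.Decidable as Decidable using (dec-true; dec-false; _×-dec_; ¬?; decidable-stable)

==⇒≡ : ∀ {n} {i j : Fin n} → (i == j) ≡ true → i ≡ j
==⇒≡ {i = i} {j} e with i Fin.≟ j
... | yes i≡j = i≡j

≡⇒== : ∀ {n} {i j : Fin n} → i ≡ j → (i == j) ≡ true
≡⇒== {i = i} {j} = dec-true (i Fin.≟ j)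

≢⇒== : ∀ {n} {i j : Fin n} → i ≢ j → (i == j) ≡ false
≢⇒== {i = i} {j} = dec-false (i Fin.≟ j)

≢true⇒≡false : ∀ {b} → b ≢ true → b ≡ false
≢true⇒≡false {b} b≢true = BoolP.¬-not b≢true

<ᵇ⇒< : ∀ {m n} → (m <ᵇ n) ≡ true → m < n
<ᵇ⇒< {m} {n} e = ℕP.<ᵇ⇒< m n (Equivalence.from BoolP.T-≡ e)

<⇒<ᵇ : ∀ {m n} → m < n → (m <ᵇ n) ≡ true
<⇒<ᵇ m<n = Equivalence.to BoolP.T-≡ (ℕP.<⇒<ᵇ m<n)

≡ᵇ⇒≡ : ∀ {m n} → (m ≡ᵇ n) ≡ true → m ≡ n
≡ᵇ⇒≡ {m} {n} e = ℕP.≡ᵇ⇒≡ m n (Equivalence.from BoolP.T-≡ e)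

≡⇒≡ᵇ : ∀ {m n} → m ≡ n → (m ≡ᵇ n) ≡ true
≡⇒≡ᵇ {m} {n} m≡n = Equivalence.to BoolP.T-≡ (ℕP.≡⇒≡ᵇ m n m≡n)

if-true : ∀ {A : Set} {b} {x y : A} → b ≡ true → (if b then x else y) ≡ x
if-true refl = refl

if-false : ∀ {A : Set} {b} {x y : A} → b ≡ false → (if b then x else y) ≡ y
if-false refl = refl

count : ∀ {n} → (Fin n → Bool) → ℕ
count {zero}  g = 0
count {suc n} g = if g Fin.zero then suc (count (g ∘ Fin.suc)) else count (g ∘ Fin.suc)

count-cong : ∀ {n} {g h : Fin n → Bool} → (∀ c → g c ≡ h c) → count g ≡ count h
count-cong {zero}  g≗h = refl
count-cong {suc n} {g} {h} g≗h rewrite g≗h Fin.zero with h Fin.zero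
... | true  = cong suc (count-cong (λ c → g≗h (Fin.suc c)))
... | false = count-cong (λ c → g≗h (Fin.suc c))

count-split : ∀ {n} (g p : Fin n → Bool) →
              count g ≡ count (λ c → g c ∧ p c) + count (λ c → g c ∧ not (p c))
count-split {zero}  g p = refl
count-split {suc n} g p with g Fin.zero | p Fin.zero
... | true  | true  = cong suc (count-split (g ∘ Fin.suc) (p ∘ Fin.suc))
... | true  | false = trans (cong suc (count-split (g ∘ Fin.suc) (p ∘ Fin.suc))) (sym (ℕP.+-suc _ _))
... | false | _     = count-split (g ∘ Fin.suc) (p ∘ Fin.suc)

count-mono : ∀ {n} {g h : Fin n → Bool} → (∀ c → g c ≡ true → h c ≡ true) → count g ≤ count h
count-mono {zero} g⇒h = z≤n
count-mono {suc n} {g} {h} g⇒h with g Fin.zero in g₀ | h Fin.zero in h₀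
... | true  | true  = s≤s (count-mono (λ c → g⇒h (Fin.suc c)))
... | true  | false = contradiction (trans (sym h₀) (g⇒h Fin.zero g₀)) λ ()
... | false | true  = ℕP.m≤n⇒m≤1+n (count-mono (λ c → g⇒h (Fin.suc c)))
... | false | false = count-mono (λ c → g⇒h (Fin.suc c))

count-mono-< : ∀ {n} {g h : Fin n → Bool} → (∀ c → g c ≡ true → h c ≡ true) →
               ∀ c → g c ≡ false → h c ≡ true → count g < count h
count-mono-< {suc n} {g} {h} g⇒h Fin.zero g₀ h₀ rewrite g₀ | h₀ = s≤s (count-mono (λ c → g⇒h (Fin.suc c)))
count-mono-< {suc n} {g} {h} g⇒h (Fin.suc c) gc hc with g Fin.zero in g₀ | h Fin.zero in h₀
... | true  | true  = s≤s (count-mono-< (λ c → g⇒h (Fin.suc c)) c gc hc)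
... | true  | false = contradiction (trans (sym h₀) (g⇒h Fin.zero g₀)) λ ()
... | false | true  = ℕP.m≤n⇒m≤1+n (count-mono-< (λ c → g⇒h (Fin.suc c)) c gc hc)
... | false | false = count-mono-< (λ c → g⇒h (Fin.suc c)) c gc hc

count≡0 : ∀ {n} (g : Fin n → Bool) → (∀ c → g c ≡ false) → count g ≡ 0
count≡0 {zero}  g g≡false = refl
count≡0 {suc n} g g≡false rewrite g≡false Fin.zero = count≡0 (g ∘ Fin.suc) (λ c → g≡false (Fin.suc c))

count>0⇒witness : ∀ {n} (g : Fin n → Bool) → 0 < count g → ∃ λ c → g c ≡ true
count>0⇒witness {suc n} g pos with g Fin.zero in g₀
... | true  = Fin.zero , g₀
... | false with count>0⇒witness (g ∘ Fin.suc) pos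
...   | c , gc = Fin.suc c , gc

count-unique : ∀ {n} (g : Fin n → Bool) x → g x ≡ true → (∀ c → g c ≡ true → c ≡ x) → count g ≡ 1
count-unique {suc n} g Fin.zero gx unique rewrite gx =
  cong suc (count≡0 (g ∘ Fin.suc) (λ c → ≢true⇒≡false (λ gc → contradiction (unique (Fin.suc c) gc) λ ())))
count-unique {suc n} g (Fin.suc x) gx unique
  rewrite ≢true⇒≡false {g Fin.zero} (λ g₀ → contradiction (unique Fin.zero g₀) λ ()) =
  count-unique (g ∘ Fin.suc) x gx (λ c gc → FinP.suc-injective (unique (Fin.suc c) gc))

count-mono-≡ : ∀ {n} {g h : Fin n → Bool} → (∀ c → g c ≡ true → h c ≡ true) → count g ≡ count h → ∀ c → g c ≡ h c
count-mono-≡ {g = g} {h} g⇒h same c with g c in gc | h c in hc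
... | true  | true  = refl
... | true  | false = contradiction (trans (sym hc) (g⇒h c gc)) λ ()
... | false | false = refl
... | false | true  = contradiction same (ℕP.<⇒≢ (count-mono-< g⇒h c gc hc))

count-complement≡1 : ∀ {n k} (g h : Fin n → Bool) → count g ≡ k → suc (count (λ c → g c ∧ h c)) ≡ k →
                     count (λ c → g c ∧ not (h c)) ≡ 1
count-complement≡1 g h count≡k suc≡k = ℕP.+-cancelˡ-≡ (count (λ c → g c ∧ h c)) _ 1 (begin
  count (λ c → g c ∧ h c) + count (λ c → g c ∧ not (h c)) ≡⟨ sym (count-split g h) ⟩
  count g                                                  ≡⟨ trans count≡k (sym suc≡k) ⟩
  suc (count (λ c → g c ∧ h c))                            ≡⟨ ℕP.+-comm 1 _ ⟩
  count (λ c → g c ∧ h c) + 1                              ∎)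
  where open ≡-Reasoning

count-witness : ∀ {n} (g : Fin n → Bool) x → g x ≡ true → 1 ≤ count g
count-witness {n} g x gx =
  subst (_< count g) (count≡0 {n} (λ _ → false) (λ _ → refl)) (count-mono-< {g = λ _ → false} (λ _ ()) x refl gx)

count≡1⇒unique : ∀ {n} (g : Fin n → Bool) → count g ≡ 1 → ∀ {x y} → g x ≡ true → g y ≡ true → x ≡ y
count≡1⇒unique g count≡1 {x} {y} gx gy with x Fin.≟ y
... | yes x≡y = x≡y
... | no  x≢y = ⊥-elim (ℕP.<-irrefl refl (subst (2 ≤_) count≡1 two))
  where
  gˣ : _ → Bool
  gˣ c = g c ∧ (c == x)
  one : count gˣ ≡ 1
  one = count-unique gˣ x (trans (cong (_∧ (x == x)) gx) (≡⇒== {i = x} refl)) (λ c e → ==⇒≡ (BoolP.∧-conicalʳ _ _ e))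
  two : 2 ≤ count g
  two = subst (2 ≤_) (sym (count-split g (_== x)))
          (ℕP.+-mono-≤ (ℕP.≤-reflexive (sym one))
                       (count-witness _ y (cong₂ (λ a b → a ∧ not b) gy (≢⇒== (x≢y ∘ sym)))))

∣∣≡count : ∀ {n} (S : Subset n) → ∣ S ∣ ≡ count (lookup S)
∣∣≡count []          = refl
∣∣≡count (true ∷ S)  = cong suc (∣∣≡count S)
∣∣≡count (false ∷ S) = ∣∣≡count S

length-filterᵇ-tabulate : ∀ {n} {A : Set} (p : A → Bool) (t : Fin n → A) →
                          length (filterᵇ p (List.tabulate t)) ≡ count (p ∘ t)
length-filterᵇ-tabulate {zero}  p t = refl
length-filterᵇ-tabulate {suc n} p t with p (t Fin.zero)
... | true  = cong suc (length-filterᵇ-tabulate p (t ∘ Fin.suc))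
... | false = length-filterᵇ-tabulate p (t ∘ Fin.suc)

Subset-ext : ∀ {n} {S T : Subset n} → (∀ x → lookup S x ≡ lookup T x) → S ≡ T
Subset-ext {S = S} {T} S≗T = trans (sym (VecP.tabulate∘lookup S)) (trans (VecP.tabulate-cong S≗T) (VecP.tabulate∘lookup T))

<ᵇ-irrefl : ∀ m → (m <ᵇ m) ≡ false
<ᵇ-irrefl m = ≢true⇒≡false (λ m<m → ℕP.<-irrefl refl (<ᵇ⇒< {m} {m} m<m))

rankIn≡count : ∀ {n} (S : Subset n) c → rankIn S c ≡ count (λ j → lookup S j ∧ (toℕ j <ᵇ toℕ c))
rankIn≡count S c = length-filterᵇ-tabulate (λ j → lookup S j ∧ (toℕ j <ᵇ toℕ c)) (λ j → j)

rankIn-strictMono : ∀ {n} (S : Subset n) {c c′} → lookup S c ≡ true → toℕ c < toℕ c′ → rankIn S c < rankIn S c′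
rankIn-strictMono S {c} {c′} c∈S c<c′ = subst₂ _<_ (sym (rankIn≡count S c)) (sym (rankIn≡count S c′))
  (count-mono-< (λ j e → cong₂ _∧_ (BoolP.∧-conicalˡ _ _ e) (<⇒<ᵇ (ℕP.<-trans (<ᵇ⇒< (BoolP.∧-conicalʳ _ _ e)) c<c′)))
                c (trans (cong (lookup S c ∧_) (<ᵇ-irrefl (toℕ c))) (BoolP.∧-zeroʳ _))
                (cong₂ _∧_ c∈S (<⇒<ᵇ c<c′)))

rankIn-injective : ∀ {n} (S : Subset n) {c c′} → lookup S c ≡ true → lookup S c′ ≡ true →
                   rankIn S c ≡ rankIn S c′ → c ≡ c′
rankIn-injective S {c} {c′} c∈S c′∈S same with FinP.<-cmp c c′
... | tri≈ _ c≡c′ _ = c≡c′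
... | tri< c<c′ _ _ = contradiction same (ℕP.<⇒≢ (rankIn-strictMono S c∈S c<c′))
... | tri> _ _ c′<c = contradiction (sym same) (ℕP.<⇒≢ (rankIn-strictMono S c′∈S c′<c))

rankIn<∣∣ : ∀ {n} (S : Subset n) {c} → lookup S c ≡ true → rankIn S c < ∣ S ∣
rankIn<∣∣ S {c} c∈S = subst₂ _<_ (sym (rankIn≡count S c)) (sym (∣∣≡count S))
  (count-mono-< (λ j → BoolP.∧-conicalˡ _ _) c (trans (cong (lookup S c ∧_) (<ᵇ-irrefl (toℕ c))) (BoolP.∧-zeroʳ _)) c∈S)

rankIn-surjective : ∀ {n} (S : Subset n) r → r < ∣ S ∣ → ∃ λ c → lookup S c ≡ true × rankIn S c ≡ r
rankIn-surjective S r r<∣S∣ = Prod.map₂ (λ {c} → Prod.map₂ (trans (rankIn≡count S c))) (below S r r<∣S∣)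
  where
  below : ∀ {n} (S : Subset n) r → r < ∣ S ∣ →
          ∃ λ c → lookup S c ≡ true × count (λ j → lookup S j ∧ (toℕ j <ᵇ toℕ c)) ≡ r
  below (true ∷ S) zero _ = Fin.zero , refl , count≡0 (λ j → lookup S j ∧ false) (λ j → BoolP.∧-zeroʳ (lookup S j))
  below (true ∷ S) (suc r) (s≤s r<∣S∣) with below S r r<∣S∣
  ... | c , c∈S , rank≡r = Fin.suc c , c∈S , cong suc rank≡r
  below (false ∷ S) r r<∣S∣ with below S r r<∣S∣
  ... | c , c∈S , rank≡r = Fin.suc c , c∈S , rank≡r

∑ : ∀ {n} → (Fin n → ℚ) → ℚ
∑ {zero}  f = 0ℚ
∑ {suc n} f = f Fin.zero ℚ.+ ∑ (f ∘ Fin.suc)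

foldr-+-tabulate : ∀ {n} {A : Set} (f : A → ℚ) (t : Fin n → A) →
                   List.foldr (λ x acc → f x ℚ.+ acc) 0ℚ (List.tabulate t) ≡ ∑ (f ∘ t)
foldr-+-tabulate {zero}  f t = refl
foldr-+-tabulate {suc n} f t = cong (f (t Fin.zero) ℚ.+_) (foldr-+-tabulate f (t ∘ Fin.suc))

sumℚ≡∑ : ∀ {n} (f : Fin n → ℚ) → sumℚ f ≡ ∑ f
sumℚ≡∑ f = foldr-+-tabulate f (λ j → j)

∑-zero : ∀ {n} (f : Fin n → ℚ) → (∀ j → f j ≡ 0ℚ) → ∑ f ≡ 0ℚ
∑-zero {zero}  f f≡0 = refl
∑-zero {suc n} f f≡0 rewrite f≡0 Fin.zero | ∑-zero (f ∘ Fin.suc) (λ j → f≡0 (Fin.suc j)) = refl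

∑-single : ∀ {n} (f : Fin n → ℚ) i → (∀ j → j ≢ i → f j ≡ 0ℚ) → ∑ f ≡ f i
∑-single {suc n} f Fin.zero f≡0 =
  trans (cong (f Fin.zero ℚ.+_) (∑-zero (f ∘ Fin.suc) (λ j → f≡0 (Fin.suc j) λ ()))) (ℚP.+-identityʳ _)
∑-single {suc n} f (Fin.suc i) f≡0 rewrite f≡0 Fin.zero (λ ()) =
  trans (ℚP.+-identityˡ _) (∑-single (f ∘ Fin.suc) i (λ j j≢i → f≡0 (Fin.suc j) (j≢i ∘ FinP.suc-injective)))

∑-pair : ∀ {n} (f : Fin n → ℚ) i i′ → i ≢ i′ → (∀ j → j ≢ i → j ≢ i′ → f j ≡ 0ℚ) → ∑ f ≡ f i ℚ.+ f i′
∑-pair {suc n} f Fin.zero Fin.zero i≢i′ _ = contradiction refl i≢i′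
∑-pair {suc n} f Fin.zero (Fin.suc i′) _ f≡0 =
  cong (f Fin.zero ℚ.+_) (∑-single (f ∘ Fin.suc) i′ (λ j j≢i′ → f≡0 (Fin.suc j) (λ ()) (j≢i′ ∘ FinP.suc-injective)))
∑-pair {suc n} f (Fin.suc i) Fin.zero _ f≡0 =
  trans (cong (f Fin.zero ℚ.+_) (∑-single (f ∘ Fin.suc) i (λ j j≢i → f≡0 (Fin.suc j) (j≢i ∘ FinP.suc-injective) (λ ()))))
        (ℚP.+-comm (f Fin.zero) (f (Fin.suc i)))
∑-pair {suc n} f (Fin.suc i) (Fin.suc i′) i≢i′ f≡0 rewrite f≡0 Fin.zero (λ ()) (λ ()) =
  trans (ℚP.+-identityˡ _)
        (∑-pair (f ∘ Fin.suc) i i′ (i≢i′ ∘ cong Fin.suc)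
                (λ j j≢i j≢i′ → f≡0 (Fin.suc j) (j≢i ∘ FinP.suc-injective) (j≢i′ ∘ FinP.suc-injective)))

re dual : D → ℚ
re   = proj₁
dual = proj₂

foldr-+D : ∀ {A : Set} (π : D → ℚ) → (∀ x y → π (x +D y) ≡ π x ℚ.+ π y) → π 0D ≡ 0ℚ →
           (f : A → D) (xs : List A) →
           π (List.foldr (λ x acc → f x +D acc) 0D xs) ≡ List.foldr (λ x acc → π (f x) ℚ.+ acc) 0ℚ xs
foldr-+D π π-+ π-0 f List.[]       = π-0
foldr-+D π π-+ π-0 f (x List.∷ xs) = trans (π-+ (f x) _) (cong (π (f x) ℚ.+_) (foldr-+D π π-+ π-0 f xs))

re-sumD : ∀ {m} (f : Fin m → D) → re (sumD f) ≡ ∑ (re ∘ f)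
re-sumD {m} f = trans (foldr-+D re (λ _ _ → refl) refl f (List.allFin m)) (foldr-+-tabulate (re ∘ f) (λ j → j))

dual-sumD : ∀ {m} (f : Fin m → D) → dual (sumD f) ≡ ∑ (dual ∘ f)
dual-sumD {m} f = trans (foldr-+D dual (λ _ _ → refl) refl f (List.allFin m)) (foldr-+-tabulate (dual ∘ f) (λ j → j))

D-≡ : ∀ {s t : D} → re s ≡ re t → dual s ≡ dual t → s ≡ t
D-≡ refl refl = refl

*D-identityˡ : ∀ t → 1D *D t ≡ t
*D-identityˡ (a , b) = D-≡ (ℚP.*-identityˡ a) (begin
  1ℚ ℚ.* b ℚ.+ 0ℚ ℚ.* a ≡⟨ cong₂ ℚ._+_ (ℚP.*-identityˡ b) (ℚP.*-zeroˡ a) ⟩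
  b ℚ.+ 0ℚ              ≡⟨ ℚP.+-identityʳ b ⟩
  b                     ∎)
  where open ≡-Reasoning

*D-zeroˡ : ∀ t → 0D *D t ≡ 0D
*D-zeroˡ (a , b) = D-≡ (ℚP.*-zeroˡ a) (trans (cong₂ ℚ._+_ (ℚP.*-zeroˡ b) (ℚP.*-zeroˡ a)) (ℚP.+-identityˡ 0ℚ))

dual-*D-real : ∀ s t → dual s ≡ 0ℚ → dual t ≡ 0ℚ → dual (s *D t) ≡ 0ℚ
dual-*D-real (a , b) (c , d) refl refl = trans (cong₂ ℚ._+_ (ℚP.*-zeroʳ a) (ℚP.*-zeroˡ c)) (ℚP.+-identityˡ 0ℚ)

dual-*D-ε : ∀ s t → dual s ≡ 1ℚ → dual t ≡ 0ℚ → dual (s *D t) ≡ re t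
dual-*D-ε (a , b) (c , d) refl refl =
  trans (cong₂ ℚ._+_ (ℚP.*-zeroʳ a) (ℚP.*-identityˡ c)) (ℚP.+-identityˡ c)

_≡±_ : ℚ → ℚ → Set
y ≡± x = y ≡ x ⊎ y ≡ ℚ.- x

IsSign : ℚ → Set
IsSign x = x ≡± 1ℚ

SignIndicator : Set → ℚ → Set
SignIndicator A x = (A → IsSign x) × (¬ A → x ≡ 0ℚ)

≡±-zero : ∀ {x y} → y ≡± x → x ≡ 0ℚ → y ≡ 0ℚ
≡±-zero (inj₁ refl) x≡0 = x≡0
≡±-zero (inj₂ refl) refl = refl

≡±-sign : ∀ {x y} → y ≡± x → IsSign x → IsSign y
≡±-sign (inj₁ refl) sign        = sign
≡±-sign (inj₂ refl) (inj₁ refl) = inj₂ refl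
≡±-sign (inj₂ refl) (inj₂ refl) = inj₁ refl

SignIndicator-± : ∀ {A x y} → y ≡± x → SignIndicator A x → SignIndicator A y
SignIndicator-± y≡±x (sign , vanish) = ≡±-sign y≡±x ∘ sign , ≡±-zero y≡±x ∘ vanish

SignIndicator-resp : ∀ {A B x} → A ⇔ B → SignIndicator A x → SignIndicator B x
SignIndicator-resp A⇔B (sign , vanish) = sign ∘ Equivalence.from A⇔B , λ ¬B → vanish (¬B ∘ Equivalence.to A⇔B)

SignIndicator-absurd : ∀ {A x} → ¬ A → x ≡ 0ℚ → SignIndicator A x
SignIndicator-absurd ¬A x≡0 = (λ a → contradiction a ¬A) , λ _ → x≡0

signed : ∀ {k} → Fin k → D → D
signed j t = if (toℕ j ℕ.% 2) ℕ.≡ᵇ 0 then t else negD t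

minor : ∀ {k} → (Fin (suc k) → Fin (suc k) → D) → Fin (suc k) → Fin k → Fin k → D
minor M j a b = M (Fin.suc a) (punchIn j b)

cofactorTerm : ∀ k → (Fin (suc k) → Fin (suc k) → D) → Fin (suc k) → D
cofactorTerm k M j = M Fin.zero j *D det k (minor M j)

module Expansion (π : D → ℚ) (π-negD : ∀ t → π (negD t) ≡ ℚ.- π t)
                 (π-sumD : ∀ {m} (f : Fin m → D) → π (sumD f) ≡ ∑ (π ∘ f)) where

  π-signed : ∀ {k} (j : Fin k) t → π (signed j t) ≡± π t
  π-signed j t with (toℕ j ℕ.% 2) ℕ.≡ᵇ 0
  ... | true  = inj₁ refl
  ... | false = inj₂ (π-negD t)

  expansion-vanishes : ∀ k M → (∀ j → π (cofactorTerm k M j) ≡ 0ℚ) → π (det (suc k) M) ≡ 0ℚ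
  expansion-vanishes k M term≡0 =
    trans (π-sumD (λ j → signed j (cofactorTerm k M j))) (∑-zero _ (λ j → ≡±-zero (π-signed j _) (term≡0 j)))

  expansion-concentrated : ∀ {A} k M j₀ → (∀ j → j ≢ j₀ → π (cofactorTerm k M j) ≡ 0ℚ) →
                           SignIndicator A (π (cofactorTerm k M j₀)) → SignIndicator A (π (det (suc k) M))
  expansion-concentrated k M j₀ term≡0 indicator =
    SignIndicator-± (Sum.map (trans det≡term) (trans det≡term) (π-signed j₀ (cofactorTerm k M j₀))) indicator
    where
    det≡term : π (det (suc k) M) ≡ π (signed j₀ (cofactorTerm k M j₀))
    det≡term = trans (π-sumD (λ j → signed j (cofactorTerm k M j))) (∑-single _ j₀ (λ j j≢j₀ → ≡±-zero (π-signed j _) (term≡0 j j≢j₀)))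

open Expansion re (λ _ → refl) re-sumD
  renaming (expansion-vanishes to re-expansion-vanishes; expansion-concentrated to re-expansion-concentrated)
open Expansion dual (λ _ → refl) dual-sumD
  renaming (expansion-vanishes to dual-expansion-vanishes; expansion-concentrated to dual-expansion-concentrated)

record MatchingSupport {k} (M : Fin k → Fin k → D) : Set₁ where
  field
    _↦_          : Fin k → Fin k → Set
    _↦?_         : ∀ a b → Dec (a ↦ b)
    ↦-functional : ∀ {a b b′} → a ↦ b → a ↦ b′ → b ≡ b′
    ↦-injective  : ∀ {a a′ b} → a ↦ b → a′ ↦ b → a ≡ a′
    re-matched   : ∀ {a b} → a ↦ b → re (M a b) ≡ 1ℚ
    re-unmatched : ∀ {a b} → ¬ a ↦ b → re (M a b) ≡ 0ℚ

  Perfect : Set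
  Perfect = ∀ a → ∃ (a ↦_)

  PerfectAvoiding : Fin k → Fin k → Set
  PerfectAvoiding a₀ b₀ = ∀ a → a ≢ a₀ → ∃ λ b → b ≢ b₀ × a ↦ b

open MatchingSupport

minorSupport : ∀ {k M} → MatchingSupport {suc k} M → (j : Fin (suc k)) → MatchingSupport (minor M j)
minorSupport P j = record
  { _↦_          = λ a b → _↦_ P (Fin.suc a) (punchIn j b)
  ; _↦?_         = λ a b → _↦?_ P (Fin.suc a) (punchIn j b)
  ; ↦-functional = λ p q → FinP.punchIn-injective j _ _ (↦-functional P p q)
  ; ↦-injective  = λ p q → FinP.suc-injective (↦-injective P p q)
  ; re-matched   = re-matched P
  ; re-unmatched = re-unmatched P
  }

module _ {k M} (P : MatchingSupport {suc k} M) where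

  private
    _↦ᴾ_ = _↦_ P

  minor-perfect⇔perfect : ∀ {j} → Fin.zero ↦ᴾ j → Perfect (minorSupport P j) ⇔ Perfect P
  minor-perfect⇔perfect {j} 0↦j = mk⇔ from to
    where
    to : Perfect P → Perfect (minorSupport P j)
    to perfect a with perfect (Fin.suc a)
    ... | b , a↦b with b Fin.≟ j
    ...   | yes refl = contradiction (↦-injective P a↦b 0↦j) λ ()
    ...   | no  b≢j  = punchOut (b≢j ∘ sym) , subst (Fin.suc a ↦ᴾ_) (sym (FinP.punchIn-punchOut (b≢j ∘ sym))) a↦b
    from : Perfect (minorSupport P j) → Perfect P
    from perfect′ Fin.zero    = j , 0↦j
    from perfect′ (Fin.suc a) = punchIn j (proj₁ (perfect′ a)) , proj₂ (perfect′ a)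

  minor-perfect⇔avoidingZero : ∀ b₀ → Perfect (minorSupport P b₀) ⇔ PerfectAvoiding P Fin.zero b₀
  minor-perfect⇔avoidingZero b₀ = mk⇔ from to
    where
    to : PerfectAvoiding P Fin.zero b₀ → Perfect (minorSupport P b₀)
    to avoiding a with avoiding (Fin.suc a) (λ ())
    ... | b , b≢b₀ , a↦b = punchOut (b≢b₀ ∘ sym) , subst (Fin.suc a ↦ᴾ_) (sym (FinP.punchIn-punchOut (b≢b₀ ∘ sym))) a↦b
    from : Perfect (minorSupport P b₀) → PerfectAvoiding P Fin.zero b₀
    from perfect′ Fin.zero    a≢0 = contradiction refl a≢0
    from perfect′ (Fin.suc a) _   = punchIn b₀ (proj₁ (perfect′ a)) , FinP.punchInᵢ≢i b₀ _ , proj₂ (perfect′ a)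

  minor-avoiding⇔avoidingSuc : ∀ {j} a₀ b₀ → Fin.zero ↦ᴾ j → (j≢b₀ : j ≢ b₀) →
                               PerfectAvoiding (minorSupport P j) a₀ (punchOut j≢b₀) ⇔ PerfectAvoiding P (Fin.suc a₀) b₀
  minor-avoiding⇔avoidingSuc {j} a₀ b₀ 0↦j j≢b₀ = mk⇔ from to
    where
    to : PerfectAvoiding P (Fin.suc a₀) b₀ → PerfectAvoiding (minorSupport P j) a₀ (punchOut j≢b₀)
    to avoiding a a≢a₀ with avoiding (Fin.suc a) (a≢a₀ ∘ FinP.suc-injective)
    ... | b , b≢b₀ , a↦b with j Fin.≟ b
    ...   | yes refl = contradiction (↦-injective P a↦b 0↦j) λ ()
    ...   | no  j≢b  = punchOut j≢b
                     , (λ e → b≢b₀ (trans (sym (FinP.punchIn-punchOut j≢b))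
                                   (trans (cong (punchIn j) e) (FinP.punchIn-punchOut j≢b₀))))
                     , subst (Fin.suc a ↦ᴾ_) (sym (FinP.punchIn-punchOut j≢b)) a↦b
    from : PerfectAvoiding (minorSupport P j) a₀ (punchOut j≢b₀) → PerfectAvoiding P (Fin.suc a₀) b₀
    from avoiding′ Fin.zero    _     = j , j≢b₀ , 0↦j
    from avoiding′ (Fin.suc a) a≢a₀ with avoiding′ a (a≢a₀ ∘ cong Fin.suc)
    ... | b , b≢b₀′ , a↦b = punchIn j b
                          , (λ e → b≢b₀′ (FinP.punchIn-injective j _ _ (trans e (sym (FinP.punchIn-punchOut j≢b₀)))))
                          , a↦b

≡0⇒*≡0 : ∀ {p} q → p ≡ 0ℚ → p ℚ.* q ≡ 0ℚ
≡0⇒*≡0 q refl = ℚP.*-zeroˡ q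

≡1⇒*≡ : ∀ {p} q → p ≡ 1ℚ → p ℚ.* q ≡ q
≡1⇒*≡ q refl = ℚP.*-identityˡ q

det-re : ∀ k M (P : MatchingSupport M) → SignIndicator (Perfect P) (re (det k M))
det-re zero    M P = (λ _ → inj₁ refl) , λ ¬perfect → contradiction (λ ()) ¬perfect
det-re (suc k) M P with FinP.any? (_↦?_ P Fin.zero)
... | no unmatched =
  SignIndicator-absurd (λ perfect → unmatched (perfect Fin.zero))
    (re-expansion-vanishes k M (λ j → ≡0⇒*≡0 _ (re-unmatched P (λ 0↦j → unmatched (j , 0↦j)))))
... | yes (j , 0↦j) =
  re-expansion-concentrated k M j
    (λ j′ j′≢j → ≡0⇒*≡0 _ (re-unmatched P (λ 0↦j′ → j′≢j (↦-functional P 0↦j′ 0↦j))))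
    (subst (SignIndicator _) (sym (≡1⇒*≡ _ (re-matched P 0↦j)))
      (SignIndicator-resp (minor-perfect⇔perfect P 0↦j) (det-re k (minor M j) (minorSupport P j))))

det-dual-vanishes : ∀ k M → (∀ a b → dual (M a b) ≡ 0ℚ) → dual (det k M) ≡ 0ℚ
det-dual-vanishes zero    M real = refl
det-dual-vanishes (suc k) M real =
  dual-expansion-vanishes k M (λ j → dual-*D-real (M Fin.zero j) (det k (minor M j)) (real Fin.zero j) (det-dual-vanishes k (minor M j) (λ a b → real _ _)))

DualIsMatrixUnit : ∀ {k} → (Fin k → Fin k → D) → Fin k → Fin k → Set
DualIsMatrixUnit M a₀ b₀ = dual (M a₀ b₀) ≡ 1ℚ × (∀ a b → ¬ (a ≡ a₀ × b ≡ b₀) → dual (M a b) ≡ 0ℚ)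

minor-dualIsMatrixUnit : ∀ {k} {M : Fin (suc k) → Fin (suc k) → D} {a₀ b₀ j} →
                         DualIsMatrixUnit M (Fin.suc a₀) b₀ → (j≢b₀ : j ≢ b₀) →
                         DualIsMatrixUnit (minor M j) a₀ (punchOut j≢b₀)
minor-dualIsMatrixUnit {M = M} {a₀} {b₀} {j} (one , off) j≢b₀ =
  subst (λ b → dual (M (Fin.suc a₀) b) ≡ 1ℚ) (sym (FinP.punchIn-punchOut j≢b₀)) one ,
  λ a b ¬at → off (Fin.suc a) (punchIn j b) λ (a≡ , b≡) →
    ¬at (FinP.suc-injective a≡ , FinP.punchIn-injective j b _ (trans b≡ (sym (FinP.punchIn-punchOut j≢b₀))))

dual-*D-unit : ∀ s t → re s ≡ 1ℚ → dual s ≡ 0ℚ → dual (s *D t) ≡ dual t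
dual-*D-unit s t re≡1 dual≡0 = cong dual (trans (cong (_*D t) (D-≡ re≡1 dual≡0)) (*D-identityˡ t))

dual-*D-null : ∀ s t → re s ≡ 0ℚ → dual s ≡ 0ℚ → dual (s *D t) ≡ 0ℚ
dual-*D-null s t re≡0 dual≡0 = cong dual (trans (cong (_*D t) (D-≡ re≡0 dual≡0)) (*D-zeroˡ t))

det-dual-matrixUnit : ∀ k M (P : MatchingSupport M) a₀ b₀ → DualIsMatrixUnit M a₀ b₀ →
                      SignIndicator (PerfectAvoiding P a₀ b₀) (dual (det k M))
det-dual-matrixUnit (suc k) M P Fin.zero b₀ (one , off) =
  dual-expansion-concentrated k M b₀
    (λ j j≢b₀ → dual-*D-real (M Fin.zero j) (det k (minor M j)) (off Fin.zero j (j≢b₀ ∘ proj₂)) (minor-real j))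
    (subst (SignIndicator _) (sym (dual-*D-ε (M Fin.zero b₀) (det k (minor M b₀)) one (minor-real b₀)))
      (SignIndicator-resp (minor-perfect⇔avoidingZero P b₀) (det-re k (minor M b₀) (minorSupport P b₀))))
  where
  minor-real : ∀ j → dual (det k (minor M j)) ≡ 0ℚ
  minor-real j = det-dual-vanishes k (minor M j) (λ a b → off (Fin.suc a) (punchIn j b) (λ { (() , _) }))
det-dual-matrixUnit (suc k) M P (Fin.suc a₀) b₀ unit@(_ , off) with FinP.any? (_↦?_ P Fin.zero)
... | no unmatched =
  SignIndicator-absurd (λ avoiding → unmatched (Prod.map₂ proj₂ (avoiding Fin.zero λ ())))
    (dual-expansion-vanishes k M (λ j → dual-*D-null (M Fin.zero j) _ (re-unmatched P (unmatched ∘ (j ,_))) (row₀-real j)))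
  where
  row₀-real : ∀ j → dual (M Fin.zero j) ≡ 0ℚ
  row₀-real j = off Fin.zero j (λ { (() , _) })
... | yes (j , 0↦j) =
  dual-expansion-concentrated k M j
    (λ j′ j′≢j → dual-*D-null (M Fin.zero j′) _ (re-unmatched P (λ 0↦j′ → j′≢j (↦-functional P 0↦j′ 0↦j))) (row₀-real j′))
    (subst (SignIndicator _) (sym (dual-*D-unit (M Fin.zero j) _ (re-matched P 0↦j) (row₀-real j))) minor-indicator)
  where
  row₀-real : ∀ j → dual (M Fin.zero j) ≡ 0ℚ
  row₀-real j = off Fin.zero j (λ { (() , _) })
  minor-indicator : SignIndicator (PerfectAvoiding P (Fin.suc a₀) b₀) (dual (det k (minor M j)))
  minor-indicator with j Fin.≟ b₀
  ... | yes refl =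
    SignIndicator-absurd row₀-blocked
      (det-dual-vanishes k (minor M j) (λ a b → off (Fin.suc a) (punchIn j b) (FinP.punchInᵢ≢i j b ∘ proj₂)))
    where
    row₀-blocked : ¬ PerfectAvoiding P (Fin.suc a₀) j
    row₀-blocked avoiding with avoiding Fin.zero (λ ())
    ... | b , b≢j , 0↦b = b≢j (↦-functional P 0↦b 0↦j)
  ... | no j≢b₀ =
    SignIndicator-resp (minor-avoiding⇔avoidingSuc P a₀ b₀ 0↦j j≢b₀)
      (det-dual-matrixUnit k (minor M j) (minorSupport P j) a₀ (punchOut j≢b₀) (minor-dualIsMatrixUnit {M = M} unit j≢b₀))

record RankedIn {n k} (S : Subset n) (c : Fin n) (r : Fin k) : Set where
  constructor _,_
  field
    member : lookup S c ≡ true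
    rank≡  : rankIn S c ≡ toℕ r

RankedIn? : ∀ {n k} (S : Subset n) c (r : Fin k) → Dec (RankedIn S c r)
RankedIn? S c r = Decidable.map′ (λ (p , q) → p , q) (λ (p , q) → p , q)
                    ((lookup S c Bool.≟ true) ×-dec (rankIn S c ℕ.≟ toℕ r))

RankedIn-true : ∀ {n k} (S : Subset n) c (r : Fin k) → (lookup S c ∧ (rankIn S c ≡ᵇ toℕ r)) ≡ true → RankedIn S c r
RankedIn-true S c r e = BoolP.∧-conicalˡ _ _ e , ≡ᵇ⇒≡ (BoolP.∧-conicalʳ _ _ e)

RankedIn-false : ∀ {n k} (S : Subset n) c (r : Fin k) → ¬ RankedIn S c r → (lookup S c ∧ (rankIn S c ≡ᵇ toℕ r)) ≡ false
RankedIn-false S c r ¬ranked = ≢true⇒≡false (¬ranked ∘ RankedIn-true S c r)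

RankedIn-ᵇ : ∀ {n k} (S : Subset n) c (r : Fin k) → RankedIn S c r → (lookup S c ∧ (rankIn S c ≡ᵇ toℕ r)) ≡ true
RankedIn-ᵇ S c r (c∈S , rank≡r) = cong₂ _∧_ c∈S (≡⇒≡ᵇ rank≡r)

rankOf : ∀ {n k} (S : Subset n) {x} → lookup S x ≡ true → ∣ S ∣ ≡ k → Σ (Fin k) (RankedIn S x)
rankOf S {x} x∈S ∣S∣≡k = Fin.fromℕ< rank<k , (x∈S , sym (FinP.toℕ-fromℕ< rank<k))
  where
  rank<k : rankIn S x < _
  rank<k = subst (rankIn S x <_) ∣S∣≡k (rankIn<∣∣ S x∈S)

RankedIn-functional : ∀ {n k} {S : Subset n} {c} {r r′ : Fin k} → RankedIn S c r → RankedIn S c r′ → r ≡ r′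
RankedIn-functional (_ , rank≡r) (_ , rank≡r′) = FinP.toℕ-injective (trans (sym rank≡r) rank≡r′)

RankedIn-injective : ∀ {n k} {S : Subset n} {c c′} {r : Fin k} → RankedIn S c r → RankedIn S c′ r → c ≡ c′
RankedIn-injective {S = S} (c∈S , rank≡r) (c′∈S , rank≡r′) = rankIn-injective S c∈S c′∈S (trans rank≡r (sym rank≡r′))

withoutRank : ∀ {n k} → Subset n → Fin k → Fin n → Bool
withoutRank J a x = lookup J x ∧ not (rankIn J x ≡ᵇ toℕ a)

-- (J ∖ {j}) ∪ {c}, where j is the element of J of rank a (ranks count from 0).
exchange : ∀ {n k} → Subset n → Fin k → Fin n → Subset n
exchange J a c = Vec.tabulate (λ x → (x == c) ∨ withoutRank J a x)

lookup-exchange : ∀ {n k} (J : Subset n) (a : Fin k) c x → lookup (exchange J a c) x ≡ (x == c) ∨ withoutRank J a x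
lookup-exchange J a c x = VecP.lookup∘tabulate _ x

exchange-member : ∀ {n k} (J : Subset n) (a : Fin k) c x → lookup (exchange J a c) x ≡ true → x ≡ c ⊎ withoutRank J a x ≡ true
exchange-member J a c x x∈E with x Fin.≟ c
... | yes x≡c = inj₁ x≡c
... | no  x≢c = inj₂ (trans (sym (cong (_∨ withoutRank J a x) (≢⇒== x≢c))) (trans (sym (lookup-exchange J a c x)) x∈E))

elementOfRank : ∀ {n k} (S : Subset n) → ∣ S ∣ ≡ k → (r : Fin k) → ∃ λ x → RankedIn S x r
elementOfRank S ∣S∣≡k r with rankIn-surjective S (toℕ r) (subst (toℕ r <_) (sym ∣S∣≡k) (FinP.toℕ<n r))
... | x , x∈S , rank≡r = x , (x∈S , rank≡r)

withoutRank-≢ : ∀ {n k} (J : Subset n) {x} {a a′ : Fin k} → withoutRank J a′ x ≡ true → RankedIn J x a → a ≢ a′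
withoutRank-≢ J x∈J∖a′ inJ a≡a′ =
  contradiction (trans (cong not (sym (≡⇒≡ᵇ (trans (RankedIn.rank≡ inJ) (cong toℕ a≡a′))))) (BoolP.∧-conicalʳ _ _ x∈J∖a′)) λ ()

ranked-withoutRank : ∀ {n k} (J : Subset n) {x} {a a′ : Fin k} → RankedIn J x a → a ≢ a′ → withoutRank J a′ x ≡ true
ranked-withoutRank J (x∈J , rank≡a) a≢a′ =
  cong₂ (λ m r → m ∧ not r) x∈J (≢true⇒≡false (a≢a′ ∘ FinP.toℕ-injective ∘ trans (sym rank≡a) ∘ ≡ᵇ⇒≡))

module _ {n k} (J : Subset n) (∣J∣≡k : ∣ J ∣ ≡ k) where

  count-rankIn : ∀ (a : Fin k) → count (λ x → lookup J x ∧ (rankIn J x ≡ᵇ toℕ a)) ≡ 1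
  count-rankIn a with rankIn-surjective J (toℕ a) (subst (toℕ a <_) (sym ∣J∣≡k) (FinP.toℕ<n a))
  ... | x , x∈J , rank≡a = count-unique _ x (RankedIn-ᵇ J x a (x∈J , rank≡a))
                             (λ y e → RankedIn-injective (RankedIn-true J y a e) (x∈J , rank≡a))

  suc-count-unranked : ∀ (a : Fin k) → suc (count (withoutRank J a)) ≡ k
  suc-count-unranked a = begin
    suc (count (withoutRank J a))                            ≡⟨ cong (_+ count (withoutRank J a)) (sym (count-rankIn a)) ⟩
    count (λ x → lookup J x ∧ (rankIn J x ≡ᵇ toℕ a)) + count (withoutRank J a)
                                                             ≡⟨ sym (count-split (lookup J) (λ x → rankIn J x ≡ᵇ toℕ a)) ⟩
    count (lookup J)                                         ≡⟨ sym (∣∣≡count J) ⟩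
    ∣ J ∣                                                    ≡⟨ ∣J∣≡k ⟩
    k                                                        ∎
    where open ≡-Reasoning

  module _ (a : Fin k) {c} (c∉J : lookup J c ≡ false) where

    exchange-without-c : ∀ x → lookup (exchange J a c) x ∧ not (x == c) ≡ withoutRank J a x
    exchange-without-c x rewrite lookup-exchange J a c x with x Fin.≟ c
    ... | yes refl rewrite c∉J = refl
    ... | no  _                = BoolP.∧-identityʳ _

    exchange-∩ : ∀ x → lookup (exchange J a c) x ∧ lookup J x ≡ withoutRank J a x
    exchange-∩ x rewrite lookup-exchange J a c x with x Fin.≟ c
    ... | yes refl rewrite c∉J = refl
    ... | no  _ with lookup J x
    ...   | true  = BoolP.∧-identityʳ _
    ...   | false = refl

    ∣exchange∣ : ∣ exchange J a c ∣ ≡ k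
    ∣exchange∣ = begin
      ∣ exchange J a c ∣                ≡⟨ ∣∣≡count (exchange J a c) ⟩
      count (lookup (exchange J a c))   ≡⟨ count-split _ (_== c) ⟩
      count (λ x → lookup (exchange J a c) x ∧ (x == c)) + count (λ x → lookup (exchange J a c) x ∧ not (x == c))
                                        ≡⟨ cong₂ _+_ only-c (count-cong exchange-without-c) ⟩
      suc (count (withoutRank J a))     ≡⟨ suc-count-unranked a ⟩
      k                                 ∎
      where
      open ≡-Reasoning
      only-c : count (λ x → lookup (exchange J a c) x ∧ (x == c)) ≡ 1
      only-c = count-unique _ c (cong₂ _∧_ c∈exchange (≡⇒== {i = c} refl)) (λ x e → ==⇒≡ (BoolP.∧-conicalʳ _ _ e))
        where
        c∈exchange : lookup (exchange J a c) c ≡ true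
        c∈exchange = trans (lookup-exchange J a c c) (cong (_∨ withoutRank J a c) (≡⇒== {i = c} refl))

    exchange⊆⇒≡ : ∀ {I} → ∣ I ∣ ≡ k → (∀ x → lookup (exchange J a c) x ≡ true → lookup I x ≡ true) → I ≡ exchange J a c
    exchange⊆⇒≡ {I} ∣I∣≡k E⊆I = sym (Subset-ext (count-mono-≡ E⊆I same-size))
      where
      same-size : count (lookup (exchange J a c)) ≡ count (lookup I)
      same-size = trans (sym (∣∣≡count (exchange J a c))) (trans ∣exchange∣ (trans (sym ∣I∣≡k) (∣∣≡count I)))

    suc-∣exchange∩∣ : suc ∣ exchange J a c ∩ J ∣ ≡ k
    suc-∣exchange∩∣ = begin
      suc ∣ exchange J a c ∩ J ∣                 ≡⟨ cong suc (∣∣≡count (exchange J a c ∩ J)) ⟩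
      suc (count (lookup (exchange J a c ∩ J)))  ≡⟨ cong suc (count-cong (λ x → trans (VecP.lookup-zipWith _∧_ x (exchange J a c) J) (exchange-∩ x))) ⟩
      suc (count (withoutRank J a))              ≡⟨ suc-count-unranked a ⟩
      k                                          ∎
      where open ≡-Reasoning

record Exchange {n} k (J I : Subset n) : Set where
  field
    removed  : Fin k
    added    : Fin n
    added∉J  : lookup J added ≡ false
    I≡exchange : I ≡ exchange J removed added

near⇒exchange : ∀ {n k} (I J : Subset n) → ∣ I ∣ ≡ k → ∣ J ∣ ≡ k → suc ∣ I ∩ J ∣ ≡ k → Exchange k J I
near⇒exchange I J ∣I∣≡k ∣J∣≡k near = record
  { removed = a₀ ; added = c₀ ; added∉J = c₀∉J ; I≡exchange = exchange⊆⇒≡ J ∣J∣≡k a₀ c₀∉J ∣I∣≡k exchange⊆I }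
  where
  size : ∀ S → ∣ S ∣ ≡ _ → count (lookup S) ≡ _
  size S ∣S∣≡k = trans (sym (∣∣≡count S)) ∣S∣≡k
  near′ : suc (count (λ x → lookup I x ∧ lookup J x)) ≡ _
  near′ = trans (cong suc (sym (trans (∣∣≡count (I ∩ J)) (count-cong (λ x → VecP.lookup-zipWith _∧_ x I J))))) near
  I∖J≡1 : count (λ x → lookup I x ∧ not (lookup J x)) ≡ 1
  I∖J≡1 = count-complement≡1 (lookup I) (lookup J) (size I ∣I∣≡k) near′
  J∖I≡1 : count (λ x → lookup J x ∧ not (lookup I x)) ≡ 1
  J∖I≡1 = count-complement≡1 (lookup J) (lookup I) (size J ∣J∣≡k)
            (trans (cong suc (count-cong (λ x → BoolP.∧-comm (lookup J x) (lookup I x)))) near′)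
  c₀ = proj₁ (count>0⇒witness (λ x → lookup I x ∧ not (lookup J x)) (ℕP.≤-reflexive (sym I∖J≡1)))
  c₀∈I∖J = proj₂ (count>0⇒witness (λ x → lookup I x ∧ not (lookup J x)) (ℕP.≤-reflexive (sym I∖J≡1)))
  x₀ = proj₁ (count>0⇒witness (λ x → lookup J x ∧ not (lookup I x)) (ℕP.≤-reflexive (sym J∖I≡1)))
  x₀∈J∖I = proj₂ (count>0⇒witness (λ x → lookup J x ∧ not (lookup I x)) (ℕP.≤-reflexive (sym J∖I≡1)))
  c₀∉J : lookup J c₀ ≡ false
  c₀∉J = BoolP.not-injective (BoolP.∧-conicalʳ _ _ c₀∈I∖J)
  a₀ = proj₁ (rankOf J (BoolP.∧-conicalˡ _ _ x₀∈J∖I) ∣J∣≡k)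
  inJ₀ = proj₂ (rankOf J (BoolP.∧-conicalˡ _ _ x₀∈J∖I) ∣J∣≡k)
  exchange⊆I : ∀ x → lookup (exchange J a₀ c₀) x ≡ true → lookup I x ≡ true
  exchange⊆I x x∈E with exchange-member J a₀ c₀ x x∈E
  ... | inj₁ refl = BoolP.∧-conicalˡ _ _ c₀∈I∖J
  ... | inj₂ x∈J∖a₀ with lookup I x in x∉I
  ...   | true  = refl
  ...   | false = contradiction refl (withoutRank-≢ J (subst (λ z → withoutRank J a₀ z ≡ true) x≡x₀ x∈J∖a₀) inJ₀)
    where
    x≡x₀ : x ≡ x₀
    x≡x₀ = count≡1⇒unique (λ x → lookup J x ∧ not (lookup I x)) J∖I≡1
             (cong₂ _∧_ (BoolP.∧-conicalˡ _ _ x∈J∖a₀) (cong not x∉I)) x₀∈J∖I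

module Chart {n} k (I J : Subset n) (a₀ : Fin k) (c₀ : Fin n) where

  N : Fin k → Fin k → D
  N = colSub k I (chartDir k J a₀ c₀)

  entry : Fin k → Fin k → Fin n → D
  entry a b c = if lookup I c ∧ (rankIn I c ≡ᵇ toℕ b) then chartDir k J a₀ c₀ a c else 0D

  re-entry-0 : ∀ a b c → ¬ (RankedIn I c b × RankedIn J c a) → re (entry a b c) ≡ 0ℚ
  re-entry-0 a b c ¬both with RankedIn? I c b
  ... | no ¬inI = cong re (if-false (RankedIn-false I c b ¬inI))
  ... | yes inI = trans (cong re (if-true (RankedIn-ᵇ I c b inI))) (if-false (RankedIn-false J c a (λ inJ → ¬both (inI , inJ))))

  re-entry-1 : ∀ a b c → RankedIn I c b → RankedIn J c a → re (entry a b c) ≡ 1ℚ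
  re-entry-1 a b c inI inJ = trans (cong re (if-true (RankedIn-ᵇ I c b inI))) (if-true (RankedIn-ᵇ J c a inJ))

  dual-entry-0 : ∀ a b c → ¬ (RankedIn I c b × a ≡ a₀ × c ≡ c₀) → dual (entry a b c) ≡ 0ℚ
  dual-entry-0 a b c ¬at with RankedIn? I c b
  ... | no ¬inI = cong dual (if-false (RankedIn-false I c b ¬inI))
  ... | yes inI = trans (cong dual (if-true (RankedIn-ᵇ I c b inI)))
                        (if-false (dec-false ((a Fin.≟ a₀) ×-dec (c Fin.≟ c₀)) (λ at → ¬at (inI , at))))

  dual-entry-1 : ∀ b → RankedIn I c₀ b → dual (entry a₀ b c₀) ≡ 1ℚ
  dual-entry-1 b inI = trans (cong dual (if-true (RankedIn-ᵇ I c₀ b inI)))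
                             (if-true (dec-true ((a₀ Fin.≟ a₀) ×-dec (c₀ Fin.≟ c₀)) (refl , refl)))

  _↦ᶜ_ : Fin k → Fin k → Set
  a ↦ᶜ b = ∃ λ c → RankedIn I c b × RankedIn J c a

  support : MatchingSupport N
  support = record
    { _↦_          = _↦ᶜ_
    ; _↦?_         = λ a b → FinP.any? (λ c → RankedIn? I c b ×-dec RankedIn? J c a)
    ; ↦-functional = λ (c , inI , inJ) (c′ , inI′ , inJ′) →
                       RankedIn-functional inI (subst (λ x → RankedIn I x _) (RankedIn-injective inJ′ inJ) inI′)
    ; ↦-injective  = λ (c , inI , inJ) (c′ , inI′ , inJ′) →
                       RankedIn-functional inJ (subst (λ x → RankedIn J x _) (RankedIn-injective inI′ inI) inJ′)
    ; re-matched   = λ {a} {b} (c , inI , inJ) → trans (re-sumD (entry a b))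
                       (trans (∑-single _ c (λ c′ c′≢c → re-entry-0 a b c′ (λ (inI′ , _) → c′≢c (RankedIn-injective inI′ inI))))
                              (re-entry-1 a b c inI inJ))
    ; re-unmatched = λ {a} {b} ¬a↦b → trans (re-sumD (entry a b)) (∑-zero _ (λ c → re-entry-0 a b c (¬a↦b ∘ (c ,_))))
    }

  dualIsMatrixUnit : ∀ {b₀} → RankedIn I c₀ b₀ → DualIsMatrixUnit N a₀ b₀
  dualIsMatrixUnit {b₀} inI =
    trans (dual-sumD (entry a₀ b₀))
          (trans (∑-single _ c₀ (λ c c≢c₀ → dual-entry-0 a₀ b₀ c (c≢c₀ ∘ proj₂ ∘ proj₂))) (dual-entry-1 b₀ inI)) ,
    λ a b ¬at → trans (dual-sumD (entry a b)) (∑-zero _ (λ c → dual-entry-0 a b c λ { (inI′ , a≡a₀ , refl) →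
                  ¬at (a≡a₀ , RankedIn-functional inI′ inI) }))

  ExchangeWitness : Set
  ExchangeWitness = ∃ λ b₀ → RankedIn I c₀ b₀ × PerfectAvoiding support a₀ b₀

  jacEntry-indicator : SignIndicator ExchangeWitness (jacEntry k J I a₀ c₀)
  jacEntry-indicator with FinP.any? (RankedIn? I c₀)
  ... | yes (b₀ , inI) =
    SignIndicator-resp (mk⇔ (λ avoiding → b₀ , inI , avoiding)
                            (λ (b , inI′ , avoiding) → subst (PerfectAvoiding support a₀) (RankedIn-functional inI′ inI) avoiding))
      (det-dual-matrixUnit k N support a₀ b₀ (dualIsMatrixUnit inI))
  ... | no unranked =
    SignIndicator-absurd (λ (b , inI , _) → unranked (b , inI))
      (det-dual-vanishes k N (λ a b → trans (dual-sumD (entry a b))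
        (∑-zero _ (λ c → dual-entry-0 a b c λ { (inI , _ , refl) → unranked (b , inI) }))))

  module _ (∣I∣≡k : ∣ I ∣ ≡ k) (∣J∣≡k : ∣ J ∣ ≡ k) (c₀∉J : lookup J c₀ ≡ false) where

    exchange⊆I : ExchangeWitness → ∀ x → lookup (exchange J a₀ c₀) x ≡ true → lookup I x ≡ true
    exchange⊆I (b₀ , inI , avoiding) x x∈E with exchange-member J a₀ c₀ x x∈E
    ... | inj₁ refl = RankedIn.member inI
    ... | inj₂ x∈J∖a₀ with rankOf J (BoolP.∧-conicalˡ _ _ x∈J∖a₀) ∣J∣≡k
    ...   | a , inJ with avoiding a (withoutRank-≢ J x∈J∖a₀ inJ)
    ...     | _ , _ , y , inI′ , inJ′ = subst (λ z → lookup I z ≡ true) (RankedIn-injective inJ′ inJ) (RankedIn.member inI′)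

    witness⇒exchange : ExchangeWitness → I ≡ exchange J a₀ c₀
    witness⇒exchange witness = exchange⊆⇒≡ J ∣J∣≡k a₀ c₀∉J ∣I∣≡k (exchange⊆I witness)

    exchange⇒witness : I ≡ exchange J a₀ c₀ → ExchangeWitness
    exchange⇒witness refl = b₀ , inI₀ , avoiding
      where
      c₀∈I : lookup I c₀ ≡ true
      c₀∈I = trans (lookup-exchange J a₀ c₀ c₀) (cong (_∨ withoutRank J a₀ c₀) (≡⇒== {i = c₀} refl))
      b₀ = proj₁ (rankOf I c₀∈I ∣I∣≡k)
      inI₀ = proj₂ (rankOf I c₀∈I ∣I∣≡k)
      avoiding : PerfectAvoiding support a₀ b₀
      avoiding a a≢a₀ = b , b≢b₀ , x , inI , inJ
        where
        x = proj₁ (elementOfRank J ∣J∣≡k a)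
        inJ = proj₂ (elementOfRank J ∣J∣≡k a)
        x∈I : lookup I x ≡ true
        x∈I = trans (lookup-exchange J a₀ c₀ x)
                    (trans (cong ((x == c₀) ∨_) (ranked-withoutRank J inJ a≢a₀)) (BoolP.∨-zeroʳ (x == c₀)))
        b = proj₁ (rankOf I x∈I ∣I∣≡k)
        inI = proj₂ (rankOf I x∈I ∣I∣≡k)
        b≢b₀ : b ≢ b₀
        b≢b₀ b≡b₀ with RankedIn-injective (subst (RankedIn I x) b≡b₀ inI) inI₀
        ... | refl = contradiction (trans (sym c₀∉J) (RankedIn.member inJ)) λ ()

    jacEntry-exchange : SignIndicator (I ≡ exchange J a₀ c₀) (jacEntry k J I a₀ c₀)
    jacEntry-exchange = SignIndicator-resp (mk⇔ witness⇒exchange exchange⇒witness) jacEntry-indicator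

lookup-injective : ∀ {A : Set} {xs : List A} → Unique xs → ∀ i j → List.lookup xs i ≡ List.lookup xs j → i ≡ j
lookup-injective {xs = _ List.∷ _} (x∉xs ∷ _) Fin.zero    Fin.zero    _ = refl
lookup-injective {xs = _ List.∷ _} (x∉xs ∷ _) Fin.zero    (Fin.suc j) e = contradiction e (All.lookup x∉xs (∈-lookup j))
lookup-injective {xs = _ List.∷ _} (x∉xs ∷ _) (Fin.suc i) Fin.zero    e = contradiction (sym e) (All.lookup x∉xs (∈-lookup i))
lookup-injective {xs = _ List.∷ _} (_ ∷ unique) (Fin.suc i) (Fin.suc j) e = cong Fin.suc (lookup-injective unique i j e)

δ : ∀ {r} → Fin r → Fin r → ℚ
δ i j = if j == i then 1ℚ else 0ℚ

δ-≡ : ∀ {r} (i : Fin r) → δ i i ≡ 1ℚ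
δ-≡ i = if-true (≡⇒== {i = i} refl)

δ-≢ : ∀ {r} {i j : Fin r} → j ≢ i → δ i j ≡ 0ℚ
δ-≢ j≢i = if-false (≢⇒== j≢i)

module _ {R C : Set} (M : R → C → ℚ) where

  zeroRow⇒dependent : ∀ {r} (ρ : Fin r → R) i → (∀ col → M (ρ i) col ≡ 0ℚ) → ¬ LinIndepRows M ρ
  zeroRow⇒dependent ρ i zero-row independent = contradiction (trans (sym (δ-≡ i)) (independent (δ i) combination i)) λ ()
    where
    combination : ∀ col → sumℚ (λ j → δ i j ℚ.* M (ρ j) col) ≡ 0ℚ
    combination col = begin
      sumℚ (λ j → δ i j ℚ.* M (ρ j) col) ≡⟨ sumℚ≡∑ (λ j → δ i j ℚ.* M (ρ j) col) ⟩
      ∑ (λ j → δ i j ℚ.* M (ρ j) col)    ≡⟨ ∑-single _ i (λ j j≢i → ≡0⇒*≡0 _ (δ-≢ j≢i)) ⟩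
      δ i i ℚ.* M (ρ i) col               ≡⟨ cong (δ i i ℚ.*_) (zero-row col) ⟩
      δ i i ℚ.* 0ℚ                        ≡⟨ ℚP.*-zeroʳ (δ i i) ⟩
      0ℚ                                  ∎
      where open ≡-Reasoning

  equalRows⇒dependent : ∀ {r} (ρ : Fin r → R) i j → i ≢ j → (∀ col → M (ρ i) col ≡ M (ρ j) col) → ¬ LinIndepRows M ρ
  equalRows⇒dependent ρ i j i≢j same independent = contradiction (trans (sym coef-i) (independent coef combination i)) λ ()
    where
    coef : Fin _ → ℚ
    coef x = if x == i then 1ℚ else ℚ.- δ j x
    coef-i : coef i ≡ 1ℚ
    coef-i = if-true (≡⇒== {i = i} refl)
    coef-j : coef j ≡ ℚ.- 1ℚ
    coef-j = trans (if-false (≢⇒== (i≢j ∘ sym))) (cong ℚ.-_ (δ-≡ j))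
    term : ∀ col → Fin _ → ℚ
    term col x = coef x ℚ.* M (ρ x) col
    combination : ∀ col → sumℚ (term col) ≡ 0ℚ
    combination col = begin
      sumℚ (term col)                                   ≡⟨ sumℚ≡∑ (term col) ⟩
      ∑ (term col)                                      ≡⟨ ∑-pair (term col) i j i≢j outside ⟩
      coef i ℚ.* M (ρ i) col ℚ.+ coef j ℚ.* M (ρ j) col ≡⟨ cong₂ (λ p q → p ℚ.* M (ρ i) col ℚ.+ q ℚ.* M (ρ j) col) coef-i coef-j ⟩
      1ℚ ℚ.* M (ρ i) col ℚ.+ (ℚ.- 1ℚ) ℚ.* M (ρ j) col   ≡⟨ cong₂ ℚ._+_ (ℚP.*-identityˡ (M (ρ i) col)) (sym (ℚP.neg-distribˡ-* 1ℚ (M (ρ j) col))) ⟩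
      M (ρ i) col ℚ.- 1ℚ ℚ.* M (ρ j) col                ≡⟨ cong (λ q → M (ρ i) col ℚ.- q) (trans (ℚP.*-identityˡ _) (sym (same col))) ⟩
      M (ρ i) col ℚ.- M (ρ i) col                       ≡⟨ ℚP.+-inverseʳ (M (ρ i) col) ⟩
      0ℚ                                                ∎
      where
      open ≡-Reasoning
      outside : ∀ x → x ≢ i → x ≢ j → term col x ≡ 0ℚ
      outside x x≢i x≢j = ≡0⇒*≡0 _ (trans (if-false (≢⇒== x≢i)) (cong ℚ.-_ (δ-≢ x≢j)))

  pivots⇒independent : ∀ {r} (ρ : Fin r → R) (pivot : Fin r → C) → (∀ i → IsSign (M (ρ i) (pivot i))) →
                       (∀ i j → j ≢ i → M (ρ j) (pivot i) ≡ 0ℚ) → LinIndepRows M ρ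
  pivots⇒independent ρ pivot sign off coef combination i = sign-cancel (sign i) (begin
    coef i ℚ.* M (ρ i) (pivot i)  ≡⟨ ∑-single (term (pivot i)) i off-terms ⟨
    ∑ (term (pivot i))            ≡⟨ sumℚ≡∑ (term (pivot i)) ⟨
    sumℚ (term (pivot i))         ≡⟨ combination (pivot i) ⟩
    0ℚ                            ∎)
    where
    open ≡-Reasoning
    term : C → Fin _ → ℚ
    term col j = coef j ℚ.* M (ρ j) col
    off-terms : ∀ j → j ≢ i → term (pivot i) j ≡ 0ℚ
    off-terms j j≢i = trans (cong (coef j ℚ.*_) (off i j j≢i)) (ℚP.*-zeroʳ (coef j))
    sign-cancel : ∀ {x u} → IsSign u → x ℚ.* u ≡ 0ℚ → x ≡ 0ℚ
    sign-cancel {x} (inj₁ refl) x*1≡0 = trans (sym (ℚP.*-identityʳ x)) x*1≡0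
    sign-cancel {x} (inj₂ refl) x*-1≡0 =
      ℚP.neg-injective (trans (cong ℚ.-_ (sym (ℚP.*-identityʳ x))) (trans (ℚP.neg-distribʳ-* x 1ℚ) x*-1≡0))

  HasRank-pivots : ∀ {K : Set} → DecidableEquality K → (key : R → K) (keys : List K) → Unique keys →
                   (∀ {x x′} → key x ≡ key x′ → ∀ col → M x col ≡ M x′ col) →
                   (∀ x → ¬ key x ∈ˡ keys → ∀ col → M x col ≡ 0ℚ) →
                   (row : Fin (length keys) → R) → (∀ i → key (row i) ≡ List.lookup keys i) →
                   (pivot : Fin (length keys) → C) → (∀ i → IsSign (M (row i) (pivot i))) →
                   (∀ i x → key x ≢ List.lookup keys i → M x (pivot i) ≡ 0ℚ) →
                   HasRank M (length keys)
  HasRank-pivots _≟ᴷ_ key keys unique same-row unkeyed-zero row row-key pivot sign off =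
    (row , pivots⇒independent row pivot sign off′) , too-many
    where
    off′ : ∀ i j → j ≢ i → M (row j) (pivot i) ≡ 0ℚ
    off′ i j j≢i = off i (row j) (j≢i ∘ lookup-injective unique j i ∘ trans (sym (row-key j)))
    open Data.List.Membership.DecPropositional _≟ᴷ_ using (_∈?_)
    keyed⇒dependent : ∀ (ρ : Fin (suc (length keys)) → R) → (∀ i → key (ρ i) ∈ˡ keys) → ¬ LinIndepRows M ρ
    keyed⇒dependent ρ keyed with FinP.pigeonhole (ℕP.n<1+n (length keys)) (Any.index ∘ keyed)
    ... | i , j , i<j , same-index = equalRows⇒dependent ρ i j (FinP.<⇒≢ i<j) (same-row same-key)
      where
      same-key : key (ρ i) ≡ key (ρ j)
      same-key = trans (AnyP.lookup-index (keyed i))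
                       (trans (cong (List.lookup keys) same-index) (sym (AnyP.lookup-index (keyed j))))
    too-many : ∀ (ρ : Fin (suc (length keys)) → R) → ¬ LinIndepRows M ρ
    too-many ρ with FinP.any? (λ i → ¬? (key (ρ i) ∈? keys))
    ... | yes (i , unkeyed) = zeroRow⇒dependent ρ i (unkeyed-zero (ρ i) unkeyed)
    ... | no  none          = keyed⇒dependent ρ (λ i → decidable-stable (key (ρ i) ∈? keys) (none ∘ (i ,_)))

module _ {n} (f : Fin n → Fin n) (f-injective : ∀ {a b} → f a ≡ f b → a ≡ b) where

  prefixSet⁻ : ∀ i c → lookup (prefixSet f i) c ≡ true → ∃ λ m → toℕ m < i × f m ≡ c
  prefixSet⁻ i c c∈P with Any.satisfied (AnyP.any⁻ _ (List.allFin n)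
                             (Equivalence.from BoolP.T-≡ (trans (sym (VecP.lookup∘tabulate _ c)) c∈P)))
  ... | m , found with Equivalence.to BoolP.T-∧ found
  ...   | m<i , fm==c = m , ℕP.<ᵇ⇒< _ _ m<i , ==⇒≡ (Equivalence.to BoolP.T-≡ fm==c)

  prefixSet⁺ : ∀ i m → toℕ m < i → lookup (prefixSet f i) (f m) ≡ true
  prefixSet⁺ i m m<i = trans (VecP.lookup∘tabulate _ (f m)) (Equivalence.to BoolP.T-≡ (AnyP.any⁺ _
    (lose (∈-allFin m) (Equivalence.from BoolP.T-∧ (ℕP.<⇒<ᵇ m<i , Equivalence.from BoolP.T-≡ (≡⇒== {i = f m} refl))))))

  ∣prefixSet∣ : ∀ i → i ≤ n → ∣ prefixSet f i ∣ ≡ i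
  ∣prefixSet∣ i i≤n = trans (∣∣≡count (prefixSet f i)) (count-prefix i i≤n)
    where
    count-prefix : ∀ i → i ≤ n → count (lookup (prefixSet f i)) ≡ i
    count-prefix zero    _   = count≡0 _ (λ c → ≢true⇒≡false (λ c∈P → ℕP.n≮0 (proj₁ (proj₂ (prefixSet⁻ 0 c c∈P)))))
    count-prefix (suc i) i<n = begin
      count (lookup (prefixSet f (suc i)))                                   ≡⟨ count-split _ (_== f m*) ⟩
      count (λ c → P (suc i) c ∧ (c == f m*)) + count (λ c → P (suc i) c ∧ not (c == f m*))
                                                                             ≡⟨ cong₂ _+_ only-new (count-cong old) ⟩
      suc (count (P i))                                                      ≡⟨ cong suc (count-prefix i (ℕP.<⇒≤ i<n)) ⟩
      suc i                                                                  ∎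
      where
      open ≡-Reasoning
      P : ℕ → Fin n → Bool
      P j = lookup (prefixSet f j)
      m* = Fin.fromℕ< i<n
      m*≡i : toℕ m* ≡ i
      m*≡i = FinP.toℕ-fromℕ< i<n
      only-new : count (λ c → P (suc i) c ∧ (c == f m*)) ≡ 1
      only-new = count-unique _ (f m*)
                   (cong₂ _∧_ (prefixSet⁺ (suc i) m* (s≤s (ℕP.≤-reflexive m*≡i))) (≡⇒== {i = f m*} refl))
                   (λ c e → ==⇒≡ (BoolP.∧-conicalʳ _ _ e))
      old : ∀ c → P (suc i) c ∧ not (c == f m*) ≡ P i c
      old c = BoolP.⇔→≡ {z = true} (mk⇔ to from)
        where
        to : P (suc i) c ∧ not (c == f m*) ≡ true → P i c ≡ true
        to e with prefixSet⁻ (suc i) c (BoolP.∧-conicalˡ _ _ e)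
        ... | m , m<1+i , refl with ℕP.m<1+n⇒m<n∨m≡n m<1+i
        ...   | inj₁ m<i  = prefixSet⁺ i m m<i
        ...   | inj₂ m≡i  = contradiction (trans (sym (cong not (≡⇒== (cong f m≡m*)))) (BoolP.∧-conicalʳ _ _ e)) λ ()
          where
          m≡m* : m ≡ m*
          m≡m* = FinP.toℕ-injective (trans m≡i (sym m*≡i))
        from : P i c ≡ true → P (suc i) c ∧ not (c == f m*) ≡ true
        from c∈P with prefixSet⁻ i c c∈P
        ... | m , m<i , refl = cong₂ _∧_ (prefixSet⁺ (suc i) m (ℕP.m<n⇒m<1+n m<i))
                                         (cong not (≢⇒== (λ fm≡fm* → ℕP.<-irrefl (trans (cong toℕ (f-injective fm≡fm*)) m*≡i) m<i)))

allSubsets-complete : ∀ {n} (S : Subset n) → S ∈ˡ allSubsets n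
allSubsets-complete []                = Any.here refl
allSubsets-complete {suc n} (true ∷ S)  = ∈-++⁺ˡ (∈-map⁺ (true ∷_) (allSubsets-complete S))
allSubsets-complete {suc n} (false ∷ S) = ∈-++⁺ʳ (List.map (true ∷_) (allSubsets n)) (∈-map⁺ (false ∷_) (allSubsets-complete S))

allSubsets-unique : ∀ n → Unique (allSubsets n)
allSubsets-unique zero    = All.[] ∷ AllPairs.[]
allSubsets-unique (suc n) = Unique.++⁺ (Unique.map⁺ VecP.∷-injectiveʳ (allSubsets-unique n))
                                       (Unique.map⁺ VecP.∷-injectiveʳ (allSubsets-unique n))
                                       disjoint
  where
  disjoint : ∀ {S} → ¬ (S ∈ˡ List.map (true ∷_) (allSubsets n) × S ∈ˡ List.map (false ∷_) (allSubsets n))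
  disjoint (S∈true , S∈false) with ∈-map⁻ (true ∷_) S∈true | ∈-map⁻ (false ∷_) S∈false
  ... | _ , _ , refl | _ , _ , true∷≡false∷ = contradiction (VecP.∷-injectiveˡ true∷≡false∷) λ ()

∉⇒lookup≡false : ∀ {n} {S : Subset n} {c} → ¬ c ∈ S → lookup S c ≡ false
∉⇒lookup≡false {S = S} {c} c∉S = ≢true⇒≡false (c∉S ∘ VecP.lookup⇒[]= c S)

lookup≡false⇒∉ : ∀ {n} {S : Subset n} {c} → lookup S c ≡ false → ¬ c ∈ S
lookup≡false⇒∉ c∉S c∈S = contradiction (trans (sym c∉S) (VecP.[]=⇒lookup c∈S)) λ ()

module _ {n} (k : ℕ) (w : Permutation′ n) (dec : Fin n → Bool) (J : Subset n) (∣J∣≡k : ∣ J ∣ ≡ k) where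

  NearNonPositroid : Subset n → Set
  NearNonPositroid I = ∣ I ∣ ≡ k × ¬ InPositroid k w dec I × suc ∣ I ∩ J ∣ ≡ k

  NearNonPositroid? : ∀ I → Dec (NearNonPositroid I)
  NearNonPositroid? I = (∣ I ∣ ℕ.≟ k) ×-dec ¬? (InPositroid? k w dec I) ×-dec (suc ∣ I ∩ J ∣ ℕ.≟ k)

  nearby : List (Subset n)
  nearby = List.filter NearNonPositroid? (allSubsets n)

  nearby-near : ∀ i → NearNonPositroid (List.lookup nearby i)
  nearby-near i = proj₂ (∈-filter⁻ NearNonPositroid? {xs = allSubsets n} (∈-lookup i))

  row : Fin (length nearby) → JacRow k w dec
  row i = List.lookup nearby i , proj₁ (nearby-near i) , proj₁ (proj₂ (nearby-near i))

  Jac-exchange : ∀ (x : JacRow k w dec) a c → lookup J c ≡ false →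
                      SignIndicator (proj₁ x ≡ exchange J a c) (jacEntry k J (proj₁ x) a c)
  Jac-exchange (I , ∣I∣≡k , _) a c c∉J = Chart.jacEntry-exchange k I J a c ∣I∣≡k ∣J∣≡k c∉J

  pivot-exchange : ∀ i → Exchange k J (List.lookup nearby i)
  pivot-exchange i = near⇒exchange (List.lookup nearby i) J (proj₁ (nearby-near i)) ∣J∣≡k (proj₂ (proj₂ (nearby-near i)))

  pivot : Fin (length nearby) → JacCol k J
  pivot i = (removed , added) , lookup≡false⇒∉ added∉J
    where open Exchange (pivot-exchange i)

  unkeyed-zero : ∀ x → ¬ proj₁ x ∈ˡ nearby → ∀ col → Jac k w dec J x col ≡ 0ℚ
  unkeyed-zero x@(I , ∣I∣≡k , non-positroid) I∉nearby ((a , c) , c∉J) =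
    proj₂ (Jac-exchange x a c (∉⇒lookup≡false c∉J)) λ I≡E →
      I∉nearby (∈-filter⁺ NearNonPositroid? (allSubsets-complete I)
                 (∣I∣≡k , non-positroid , subst (λ S → suc ∣ S ∩ J ∣ ≡ k) (sym I≡E) (suc-∣exchange∩∣ J ∣J∣≡k a (∉⇒lookup≡false c∉J))))

  pivot-sign : ∀ i → IsSign (Jac k w dec J (row i) (pivot i))
  pivot-sign i = proj₁ (Jac-exchange (row i) removed added added∉J) I≡exchange
    where open Exchange (pivot-exchange i)

  pivot-off : ∀ i x → proj₁ x ≢ List.lookup nearby i → Jac k w dec J x (pivot i) ≡ 0ℚ
  pivot-off i x x≢I = proj₂ (Jac-exchange x removed added added∉J) (λ x≡E → x≢I (trans x≡E (sym I≡exchange)))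
    where open Exchange (pivot-exchange i)

  Jac-hasRank : HasRank (Jac k w dec J) (countNearby k w dec J)
  Jac-hasRank =
    HasRank-pivots (Jac k w dec J) (VecP.≡-dec Bool._≟_) proj₁ nearby
      (Unique.filter⁺ NearNonPositroid? (allSubsets-unique n))
      (λ x≡x′ ((a , c) , _) → cong (λ I → jacEntry k J I a c) x≡x′)
      unkeyed-zero row (λ _ → refl) pivot pivot-sign pivot-off

theorem1p5 : (n k : ℕ) → k ≤ n →
    (w : Permutation′ n) (dec : Fin n → Bool) → InSnk k w dec →
    (v : Permutation′ n) → IsTopPerm k w dec v →
    (y : Permutation′ n) →
    BruhatLe (λ i → w ⟨$⟩ʳ (v ⟨$⟩ʳ i)) (y ⟨$⟩ʳ_) → BruhatLe (y ⟨$⟩ʳ_) (v ⟨$⟩ʳ_) →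
    HasRank (Jac k w dec (prefixSet (y ⟨$⟩ʳ_) k)) (countNearby k w dec (prefixSet (y ⟨$⟩ʳ_) k))
theorem1p5 n k k≤n w dec _ v _ y _ _ = Jac-hasRank k w dec (prefixSet (y ⟨$⟩ʳ_) k) (∣prefixSet∣ (y ⟨$⟩ʳ_) y-injective k k≤n)
  where
  y-injective : ∀ {a b} → y ⟨$⟩ʳ a ≡ y ⟨$⟩ʳ b → a ≡ b
  y-injective {a} {b} e = trans (sym (inverseˡ y)) (trans (cong (y ⟨$⟩ˡ_) e) (inverseˡ y))
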